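{- Let $s$ and $t$ be any two odd positive integers. If $\lambda$ is a $\bar{t}$-core bar-partition, then the $\bar{s}$-core $\bar{\gamma}_s(\lambda)$ of $\lambda$ is again a $\bar{t}$-core.
   Context: A bar-partition is a partition with distinct (positive) parts. For an odd positive integer $\ell$, removing an $\ell$-bar from a bar-partition $\lambda$ means one of the following operations: (1) replacing a part $x>\ell$ by $x-\ell$, provided $x-\ell$ is not already a part of $\lambda$; (2) deleting a part equal to $\ell$; (3) deleting two parts $x,y$ with $x+y=\ell$. The $\bar{\ell}$-core $\bar{\gamma}_\ell(\lambda)$ is the bar-partition obtained by successively removing $\ell$-bars until none can be removed; it is independent of the order of removals. A bar-partition is a $\bar{\ell}$-core if no $\ell$-bar can be removed from it (equivalently, it has no bars of length divisible by $\ell$). -}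

module Defs where

open import Data.Nat using (ℕ; zero; suc; _+_; _*_; _∸_; _<_; _>_)
open import Data.Product using (∃; _×_)
open import Data.Sum using (_⊎_)
open import Data.List using (List)
open import Data.List.Membership.Propositional using (_∈_; _∉_)
open import Data.List.Relation.Unary.All using (All)
open import Data.List.Relation.Unary.Linked using (Linked)
open import Relation.Binary.PropositionalEquality using (_≡_; _≢_)
open import Relation.Binary.Construct.Closure.ReflexiveTransitive using (Star)
open import Relation.Nullary using (¬_)
open import Function.Bundles using (_⇔_)

Odd : ℕ → Set
Odd n = ∃ λ k → n ≡ suc (2 * k)

-- A bar-partition: a finite set of distinct positive integers,
-- represented canonically as a strictly decreasing list of positive naturals.
record BarPartition : Set where
  constructor mkBar
  field
    parts    : List ℕ
    positive : All (0 <_) parts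
    strict   : Linked _>_ parts
open BarPartition public

_∈ᵇ_ : ℕ → BarPartition → Set
x ∈ᵇ μ = x ∈ parts μ

data RemoveBar (ℓ : ℕ) (lam mu : BarPartition) : Set where
  shift  : (x : ℕ) → x ∈ᵇ lam → ℓ < x → ¬ ((x ∸ ℓ) ∈ᵇ lam) →
           (∀ y → (y ∈ᵇ mu) ⇔ ((y ∈ᵇ lam × y ≢ x) ⊎ y ≡ x ∸ ℓ)) →
           RemoveBar ℓ lam mu
  delete : ℓ ∈ᵇ lam →
           (∀ y → (y ∈ᵇ mu) ⇔ (y ∈ᵇ lam × y ≢ ℓ)) →
           RemoveBar ℓ lam mu
  pair   : (x y : ℕ) → x ∈ᵇ lam → y ∈ᵇ lam → x + y ≡ ℓ →
           (∀ z → (z ∈ᵇ mu) ⇔ (z ∈ᵇ lam × z ≢ x × z ≢ y)) →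
           RemoveBar ℓ lam mu

IsBarCore : ℕ → BarPartition → Set
IsBarCore ℓ lam = ∀ mu → ¬ RemoveBar ℓ lam mu

-- μ is the ℓ̄-core of λ: obtained from λ by successively removing ℓ-bars
-- until none can be removed (unique by the order-independence fact).
IsBarCoreOf : ℕ → BarPartition → BarPartition → Set
IsBarCoreOf ℓ mu lam = Star (RemoveBar ℓ) lam mu × IsBarCore ℓ mu

-- Encode a bar-partition μ whose parts are all below N as a 0-1 sequence (an abacus): position
-- N + p carries a bead iff p is a part, position N - p iff p is not. Then μ is an ℓ̄-core iff
-- its sequence is ℓ-flush (every bead can move ℓ places down onto a bead), and removing an
-- s-bar exchanges the contents of one or two pairs of positions congruent modulo s, so it keeps
-- the number of beads on every runner (residue class modulo s). Let F and G be the sequences of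
-- λ and of its s̄-core μ: F is t-flush, G is s-flush, and they agree on every runner count.
-- Suppose G had a bead at x = t + y but not at y. On the runner of x, G has a bead at each of
-- the positions up to x; F has at most the positions below t together with its beads on the
-- runner of y; and G, with as many beads there, has them all below y. That is one bead short,
-- so G is t-flush, which makes μ a t̄-core.
module Submission where

open import Defs
open import Data.Bool using (Bool; true; false; not; _∧_)
open import Data.Empty using (⊥-elim)
open import Data.List using (List; _∷_; filter; downFrom)
open import Data.List.Membership.Propositional using (_∈_; _∉_)
open import Data.List.Membership.Propositional.Properties using (∈-filter⁺; ∈-filter⁻; ∈-downFrom⁺)
open import Data.List.Relation.Unary.All as All using ()
open import Data.List.Relation.Unary.Any using (here; there)
open import Data.List.Relation.Unary.Linked.Properties as Linked using (applyDownFrom⁺₂)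
open import Data.Nat
open import Data.Nat.DivMod
open import Data.Nat.ListAction using (sum)
open import Data.Nat.Properties
open import Data.List.Membership.DecPropositional _≟_ using (_∈?_)
open import Data.Product using (∃; _,_; proj₁; proj₂; _×_)
open import Data.Sum using (_⊎_; inj₁; inj₂)
open import Function.Base using (_∘_; id)
open import Function.Bundles using (_⇔_; mk⇔; Equivalence)
open import Relation.Binary.Construct.Closure.ReflexiveTransitive using (Star; ε; _◅_)
open import Relation.Binary.Definitions using (tri<; tri≈; tri>)
open import Relation.Binary.PropositionalEquality
open import Relation.Nullary using (Dec; yes; no; does; ¬_; ¬?; contradiction)
open import Relation.Nullary.Decidable using (dec-true; dec-false; does-⇔; _×-dec_; _⊎-dec_)
open import Relation.Unary using (Decidable)

open import Algebra.Properties.CommutativeSemigroup +-commutativeSemigroup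
  using (xy∙z≈xz∙y; xy∙z≈zx∙y; x∙yz≈z∙yx; x∙yz≈y∙xz)

sumBelow : ℕ → (ℕ → ℕ) → ℕ
sumBelow zero    f = 0
sumBelow (suc n) f = sumBelow n f + f n

sumBelow-cong : ∀ n {f g} → (∀ {i} → i < n → f i ≡ g i) → sumBelow n f ≡ sumBelow n g
sumBelow-cong zero    eq = refl
sumBelow-cong (suc n) eq = cong₂ _+_ (sumBelow-cong n (λ i<n → eq (m<n⇒m<1+n i<n))) (eq (n<1+n n))

sumBelow-mono : ∀ n {f g} → (∀ {i} → i < n → f i ≤ g i) → sumBelow n f ≤ sumBelow n g
sumBelow-mono zero    le = z≤n
sumBelow-mono (suc n) le = +-mono-≤ (sumBelow-mono n (λ i<n → le (m<n⇒m<1+n i<n))) (le (n<1+n n))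

sumBelow-monoˡ : ∀ f {m n} → m ≤ n → sumBelow m f ≤ sumBelow n f
sumBelow-monoˡ f m≤n = go (≤⇒≤′ m≤n)
  where
  go : ∀ {m n} → m ≤′ n → sumBelow m f ≤ sumBelow n f
  go ≤′-refl       = ≤-refl
  go (≤′-step m≤n) = ≤-trans (go m≤n) (m≤m+n _ _)

sumBelow-+ : ∀ m n f → sumBelow (m + n) f ≡ sumBelow m f + sumBelow n (λ i → f (m + i))
sumBelow-+ m zero    f = trans (cong (λ k → sumBelow k f) (+-identityʳ m)) (sym (+-identityʳ _))
sumBelow-+ m (suc n) f = begin
  sumBelow (m + suc n) f                                  ≡⟨ cong (λ k → sumBelow k f) (+-suc m n) ⟩
  sumBelow (m + n) f + f (m + n)                          ≡⟨ cong (_+ f (m + n)) (sumBelow-+ m n f) ⟩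
  sumBelow m f + sumBelow n (λ i → f (m + i)) + f (m + n) ≡⟨ +-assoc (sumBelow m f) _ _ ⟩
  sumBelow m f + sumBelow (suc n) (λ i → f (m + i))       ∎
  where open ≡-Reasoning

sumBelow-zero : ∀ n → sumBelow n (λ _ → 0) ≡ 0
sumBelow-zero zero    = refl
sumBelow-zero (suc n) = trans (+-identityʳ _) (sumBelow-zero n)

-- Phrased without subtraction.
sumBelow-update : ∀ {n a f g} → a < n → (∀ {i} → i ≢ a → g i ≡ f i) →
                  sumBelow n g + f a ≡ sumBelow n f + g a
sumBelow-update {suc n} {a} {f} {g} a<1+n g≗f with m<1+n⇒m<n∨m≡n a<1+n
... | inj₁ a<n = begin
  sumBelow n g + g n + f a ≡⟨ xy∙z≈xz∙y _ (g n) (f a) ⟩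
  sumBelow n g + f a + g n ≡⟨ cong₂ _+_ (sumBelow-update a<n g≗f) (g≗f (<⇒≢ a<n ∘ sym)) ⟩
  sumBelow n f + g a + f n ≡⟨ xy∙z≈xz∙y _ (g a) (f n) ⟩
  sumBelow n f + f n + g a ∎
  where open ≡-Reasoning
... | inj₂ refl = begin
  sumBelow n g + g a + f a ≡⟨ cong (λ m → m + g a + f a) (sumBelow-cong n (λ i<n → g≗f (<⇒≢ i<n))) ⟩
  sumBelow n f + g a + f a ≡⟨ xy∙z≈xz∙y _ (g a) (f a) ⟩
  sumBelow n f + f a + g a ∎
  where open ≡-Reasoning

record Exchange {A : Set} (a b : ℕ) (f g : ℕ → A) : Set where
  field
    at-a      : g a ≡ f b
    at-b      : g b ≡ f a
    elsewhere : ∀ {i} → i ≢ a → i ≢ b → g i ≡ f i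

record Exchange₂ {A : Set} (a b c d : ℕ) (f g : ℕ → A) : Set where
  field
    at-a      : g a ≡ f b
    at-b      : g b ≡ f a
    at-c      : g c ≡ f d
    at-d      : g d ≡ f c
    elsewhere : ∀ {i} → i ≢ a → i ≢ b → i ≢ c → i ≢ d → g i ≡ f i

sumBelow-exchange : ∀ {n a b f g} → a < n → b < n → Exchange a b f g → sumBelow n g ≡ sumBelow n f
sumBelow-exchange {n} {a} {b} {f} {g} a<n b<n ex with a ≟ b
... | yes refl = sumBelow-cong n g≗f
  where
  open Exchange ex
  g≗f : ∀ {i} → i < n → g i ≡ f i
  g≗f {i} _ with i ≟ a
  ... | yes refl = at-a
  ... | no i≢a   = elsewhere i≢a i≢a
... | no a≢b = +-cancelʳ-≡ (f b) _ _ (begin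
  sumBelow n g + f b ≡⟨ cong (sumBelow n g +_) (sym (h-off-a (a≢b ∘ sym))) ⟩
  sumBelow n g + h b ≡⟨ sumBelow-update b<n g≗h ⟩
  sumBelow n h + g b ≡⟨ cong (sumBelow n h +_) at-b ⟩
  sumBelow n h + f a ≡⟨ sumBelow-update a<n h-off-a ⟩
  sumBelow n f + h a ≡⟨ cong (sumBelow n f +_) h-at-a ⟩
  sumBelow n f + f b ∎)
  where
  open Exchange ex
  open ≡-Reasoning
  -- Pass from f to g through h, which agrees with f except that h a = f b.
  h : ℕ → ℕ
  h i with i ≟ a
  ... | yes _ = f b
  ... | no _  = f i
  h-at-a : h a ≡ f b
  h-at-a with a ≟ a
  ... | yes _  = refl
  ... | no a≢a = contradiction refl a≢a
  h-off-a : ∀ {i} → i ≢ a → h i ≡ f i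
  h-off-a {i} i≢a with i ≟ a
  ... | yes i≡a = contradiction i≡a i≢a
  ... | no _    = refl
  g≗h : ∀ {i} → i ≢ b → g i ≡ h i
  g≗h {i} i≢b with i ≟ a
  ... | yes refl = at-a
  ... | no i≢a   = elsewhere i≢a i≢b

exchange₂-split : ∀ {A : Set} {a b c d} {f g : ℕ → A} → c ≢ a → c ≢ b → d ≢ a → d ≢ b →
                  Exchange₂ a b c d f g → ∃ λ h → Exchange c d f h × Exchange a b h g
exchange₂-split {A} {a} {b} {c} {d} {f} {g} c≢a c≢b d≢a d≢b ex =
  h , record { at-a = trans (h-off-ab c≢a c≢b) at-c
             ; at-b = trans (h-off-ab d≢a d≢b) at-d
             ; elsewhere = h≗f }
    , record { at-a = trans at-a (sym h-at-b)
             ; at-b = trans at-b (sym h-at-a)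
             ; elsewhere = λ i≢a i≢b → sym (h-off-ab i≢a i≢b) }
  where
  open Exchange₂ ex
  h : ℕ → A
  h i with i ≟ a | i ≟ b
  ... | no _ | no _ = g i
  ... | _    | _    = f i
  h-at-a : h a ≡ f a
  h-at-a with a ≟ a | a ≟ b
  ... | yes _  | _ = refl
  ... | no a≢a | _ = contradiction refl a≢a
  h-at-b : h b ≡ f b
  h-at-b with b ≟ a | b ≟ b
  ... | yes _ | _      = refl
  ... | no _  | yes _  = refl
  ... | no _  | no b≢b = contradiction refl b≢b
  h-off-ab : ∀ {i} → i ≢ a → i ≢ b → h i ≡ g i
  h-off-ab {i} i≢a i≢b with i ≟ a | i ≟ b
  ... | no _    | no _    = refl
  ... | yes i≡a | _       = contradiction i≡a i≢a
  ... | no _    | yes i≡b = contradiction i≡b i≢b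
  h≗f : ∀ {i} → i ≢ c → i ≢ d → h i ≡ f i
  h≗f {i} i≢c i≢d with i ≟ a | i ≟ b
  ... | no i≢a | no i≢b = elsewhere i≢a i≢b i≢c i≢d
  ... | yes _  | _      = refl
  ... | no _   | yes _  = refl

dec-true⁻ : ∀ {A : Set} (a? : Dec A) → does a? ≡ true → A
dec-true⁻ (yes a) _ = a

indicator : Bool → ℕ
indicator true  = 1
indicator false = 0

indicator-∧ˡ : ∀ b c → indicator (b ∧ c) ≤ indicator b
indicator-∧ˡ true  true  = ≤-refl
indicator-∧ˡ true  false = z≤n
indicator-∧ˡ false c     = z≤n

Flush : ℕ → (ℕ → Bool) → Set
Flush ℓ F = ∀ n → F (ℓ + n) ≡ true → F n ≡ true

module _ (d : ℕ) .{{_ : NonZero d}} where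

  %≡%⇒≡+* : ∀ {m n} → m ≤ n → m % d ≡ n % d → ∃ λ k → n ≡ m + k * d
  %≡%⇒≡+* {m} {n} m≤n m%≡n% = n / d ∸ m / d , (begin
    n                                          ≡⟨ m≡m%n+[m/n]*n n d ⟩
    n % d + n / d * d                          ≡⟨ cong (λ q → n % d + q * d) (m+[n∸m]≡n (/-monoˡ-≤ d m≤n)) ⟨
    n % d + (m / d + (n / d ∸ m / d)) * d      ≡⟨ cong (n % d +_) (*-distribʳ-+ d (m / d) _) ⟩
    n % d + (m / d * d + (n / d ∸ m / d) * d)  ≡⟨ +-assoc (n % d) _ _ ⟨
    n % d + m / d * d + (n / d ∸ m / d) * d    ≡⟨ cong (λ r → r + m / d * d + (n / d ∸ m / d) * d) m%≡n% ⟨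
    m % d + m / d * d + (n / d ∸ m / d) * d    ≡⟨ cong (_+ (n / d ∸ m / d) * d) (m≡m%n+[m/n]*n m d) ⟨
    m + (n / d ∸ m / d) * d                    ∎)
    where open ≡-Reasoning

  +-congˡ-%≡ : ∀ t {m n} → m % d ≡ n % d → (t + m) % d ≡ (t + n) % d
  +-congˡ-%≡ t {m} {n} eq = begin
    (t + m) % d           ≡⟨ %-distribˡ-+ t m d ⟩
    (t % d + m % d) % d   ≡⟨ cong (λ r → (t % d + r) % d) eq ⟩
    (t % d + n % d) % d   ≡⟨ %-distribˡ-+ t n d ⟨
    (t + n) % d           ∎
    where open ≡-Reasoning

  -- m ≡ m + t * d = t * (d - 1) + (t + m) modulo d.
  +-cancelˡ-%≡ : ∀ t {m n} → (t + m) % d ≡ (t + n) % d → m % d ≡ n % d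
  +-cancelˡ-%≡ t {m} {n} eq = begin
    m % d                        ≡⟨ undo-shift m ⟩
    (t * pred d + (t + m)) % d   ≡⟨ +-congˡ-%≡ (t * pred d) eq ⟩
    (t * pred d + (t + n)) % d   ≡⟨ undo-shift n ⟨
    n % d                        ∎
    where
    open ≡-Reasoning
    undo-shift : ∀ k → k % d ≡ (t * pred d + (t + k)) % d
    undo-shift k = begin
      k % d                        ≡⟨ [m+kn]%n≡m%n k t d ⟨
      (k + t * d) % d              ≡⟨ cong (λ e → (k + t * e) % d) (suc-pred d) ⟨
      (k + t * suc (pred d)) % d   ≡⟨ cong (λ e → (k + e) % d) (*-suc t (pred d)) ⟩
      (k + (t + t * pred d)) % d   ≡⟨ cong (_% d) (x∙yz≈z∙yx k t (t * pred d)) ⟩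
      (t * pred d + (t + k)) % d   ∎

module Runners (s : ℕ) .{{_ : NonZero s}} where

  onRunner : ℕ → ℕ → Bool
  onRunner x i = does (i % s ≟ x % s)

  beads : (ℕ → Bool) → ℕ → ℕ → ℕ
  beads F x n = sumBelow n (λ i → indicator (onRunner x i ∧ F i))

  positions : ℕ → ℕ → ℕ
  positions x n = sumBelow n (λ i → indicator (onRunner x i))

  onRunner-self : ∀ x → onRunner x x ≡ true
  onRunner-self x = dec-true (x % s ≟ x % s) refl

  onRunner-+ˡ : ∀ t x i → onRunner (t + x) (t + i) ≡ onRunner x i
  onRunner-+ˡ t x i = does-⇔ (mk⇔ (+-cancelˡ-%≡ s t) (+-congˡ-%≡ s t)) ((t + i) % s ≟ (t + x) % s) (i % s ≟ x % s)

  positions-+ : ∀ t y → positions (t + y) (t + y) ≡ positions (t + y) t + positions y y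
  positions-+ t y = trans (sumBelow-+ t y _)
    (cong (positions (t + y) t +_) (sumBelow-cong y (λ {i} _ → cong indicator (onRunner-+ˡ t y i))))

  flush-iterate : ∀ {G} → Flush s G → ∀ k i → G (i + k * s) ≡ true → G i ≡ true
  flush-iterate {G} flush zero    i Gi = subst (λ m → G m ≡ true) (+-identityʳ i) Gi
  flush-iterate {G} flush (suc k) i Gi =
    flush-iterate flush k i (flush (i + k * s) (subst (λ m → G m ≡ true) (x∙yz≈y∙xz i s (k * s)) Gi))

  flush-down : ∀ {G x i} → Flush s G → G x ≡ true → i ≤ x → i % s ≡ x % s → G i ≡ true
  flush-down {G} {x} {i} flush Gx i≤x i≡x with k , refl ← %≡%⇒≡+* s i≤x i≡x = flush-iterate flush k i Gx

  positions≤beads : ∀ {G x n} → Flush s G → G x ≡ true → x < n → positions x (suc x) ≤ beads G x n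
  positions≤beads {G} {x} {n} flush Gx x<n = begin
    positions x (suc x) ≤⟨ sumBelow-mono (suc x) full-below ⟩
    beads G x (suc x)   ≤⟨ sumBelow-monoˡ _ x<n ⟩
    beads G x n         ∎
    where
    open ≤-Reasoning
    full-below : ∀ {i} → i < suc x → indicator (onRunner x i) ≤ indicator (onRunner x i ∧ G i)
    full-below {i} i≤x with onRunner x i in i∼x
    ... | false = z≤n
    ... | true rewrite flush-down flush Gx (≤-pred i≤x) (dec-true⁻ (i % s ≟ x % s) i∼x) = ≤-refl

  beads≤positions : ∀ {G y n} → Flush s G → G y ≡ false → beads G y n ≤ positions y y
  beads≤positions {G} {y} {n} flush Gy = begin
    beads G y n                ≤⟨ sumBelow-monoˡ _ (m≤n+m n y) ⟩
    beads G y (y + n)          ≡⟨ sumBelow-+ y n _ ⟩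
    beads G y y + sumBelow n _ ≡⟨ cong (beads G y y +_) (trans (sumBelow-cong n empty-above) (sumBelow-zero n)) ⟩
    beads G y y + 0            ≡⟨ +-identityʳ _ ⟩
    beads G y y                ≤⟨ sumBelow-mono y (λ {i} _ → indicator-∧ˡ (onRunner y i) (G i)) ⟩
    positions y y              ∎
    where
    open ≤-Reasoning
    empty-above : ∀ {k} → k < n → indicator (onRunner y (y + k) ∧ G (y + k)) ≡ 0
    empty-above {k} _ with onRunner y (y + k) in y+k∼y | G (y + k) in Gy+k
    ... | false | _     = refl
    ... | true  | false = refl
    ... | true  | true  = contradiction (trans (sym Gy) down) λ ()
      where
      down : G y ≡ true
      down = flush-down flush Gy+k (m≤m+n y k) (sym (dec-true⁻ ((y + k) % s ≟ y % s) y+k∼y))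

  beads-+ : ∀ {F} t y n → Flush t F → beads F (t + y) (t + n) ≤ positions (t + y) t + beads F y n
  beads-+ {F} t y n flush = begin
    beads F (t + y) (t + n)             ≡⟨ sumBelow-+ t n _ ⟩
    beads F (t + y) t + sumBelow n _    ≤⟨ +-mono-≤ (sumBelow-mono t (λ {i} _ → indicator-∧ˡ (onRunner (t + y) i) (F i)))
                                                    (sumBelow-mono n moved-down) ⟩
    positions (t + y) t + beads F y n   ∎
    where
    open ≤-Reasoning
    moved-down : ∀ {k} → k < n → indicator (onRunner (t + y) (t + k) ∧ F (t + k)) ≤ indicator (onRunner y k ∧ F k)
    moved-down {k} _ rewrite onRunner-+ˡ t y k with onRunner y k | F (t + k) in Ft+k
    ... | false | _     = z≤n
    ... | true  | false = z≤n
    ... | true  | true  rewrite flush k Ft+k = ≤-refl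

  flush-transfer : ∀ {t W F G} → Flush t F → Flush s G → (∀ x → beads G x W ≡ beads F x W) →
                   (∀ {i} → W ≤ i → G i ≡ false) → Flush t G
  flush-transfer {t} {W} {F} {G} flushF flushG same empty y Gx with G y in Gy
  ... | true  = refl
  ... | false = ⊥-elim (<-irrefl refl (begin-strict
    positions x (suc x)              ≤⟨ positions≤beads flushG Gx x<W ⟩
    beads G x W                      ≡⟨ same x ⟩
    beads F x W                      ≡⟨ cong (beads F x) W≡t+n ⟨
    beads F x (t + n)                ≤⟨ beads-+ t y n flushF ⟩
    positions x t + beads F y n      ≤⟨ +-monoʳ-≤ (positions x t) (sumBelow-monoˡ _ (m∸n≤m W t)) ⟩
    positions x t + beads F y W      ≡⟨ cong (positions x t +_) (same y) ⟨
    positions x t + beads G y W      ≤⟨ +-monoʳ-≤ (positions x t) (beads≤positions {n = W} flushG Gy) ⟩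
    positions x t + positions y y    ≡⟨ positions-+ t y ⟨
    positions x x                    <⟨ m<m+n (positions x x) (subst (λ b → 0 < indicator b) (sym (onRunner-self x)) z<s) ⟩
    positions x (suc x)              ∎))
    where
    open ≤-Reasoning
    x : ℕ
    x = t + y
    n : ℕ
    n = W ∸ t
    x<W : x < W
    x<W = ≰⇒> (λ W≤x → contradiction (trans (sym Gx) (empty W≤x)) λ ())
    W≡t+n : t + n ≡ W
    W≡t+n = m+[n∸m]≡n (≤-trans (m≤m+n t y) (<⇒≤ x<W))

  beads-exchange : ∀ {F G a b n} → a < n → b < n → a % s ≡ b % s → Exchange a b F G →
                   ∀ x → beads G x n ≡ beads F x n
  beads-exchange {F} {G} {a} {b} a<n b<n a∼b ex x = sumBelow-exchange a<n b<n (record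
    { at-a      = cong₂ (λ r v → indicator (r ∧ v)) same-runner at-a
    ; at-b      = cong₂ (λ r v → indicator (r ∧ v)) (sym same-runner) at-b
    ; elsewhere = λ {i} i≢a i≢b → cong (λ v → indicator (onRunner x i ∧ v)) (elsewhere i≢a i≢b)
    })
    where
    open Exchange ex
    same-runner : onRunner x a ≡ onRunner x b
    same-runner = cong (λ r → does (r ≟ x % s)) a∼b

  beads-exchange₂ : ∀ {F G a b c d n} → a < n → b < n → c < n → d < n →
                    a % s ≡ b % s → c % s ≡ d % s → c ≢ a → c ≢ b → d ≢ a → d ≢ b →
                    Exchange₂ a b c d F G → ∀ x → beads G x n ≡ beads F x n
  beads-exchange₂ a<n b<n c<n d<n a∼b c∼d c≢a c≢b d≢a d≢b ex x
    with H , F⇄H , H⇄G ← exchange₂-split c≢a c≢b d≢a d≢b ex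
    = trans (beads-exchange a<n b<n a∼b H⇄G x) (beads-exchange c<n d<n c∼d F⇄H x)

∈⇒≤sum : ∀ {y xs} → y ∈ xs → y ≤ sum xs
∈⇒≤sum (here refl)         = m≤m+n _ _
∈⇒≤sum {xs = x ∷ _} (there y∈) = ≤-trans (∈⇒≤sum y∈) (m≤n+m _ x)

barPartition-of : ∀ M {P : ℕ → Set} → Decidable P → (∀ {y} → P y → 0 < y × y < M) →
                  ∃ λ μ → ∀ y → y ∈ᵇ μ ⇔ P y
barPartition-of M {P} P? bounded =
  mkBar ys (All.tabulate (proj₁ ∘ bounded ∘ P-of))
           (Linked.filter⁺ P? (λ y>z z>w → <-trans z>w y>z) (applyDownFrom⁺₂ id M n<1+n))
  , λ y → mk⇔ P-of (λ Py → ∈-filter⁺ P? (∈-downFrom⁺ (proj₂ (bounded Py))) Py)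
  where
  ys : List ℕ
  ys = filter P? (downFrom M)
  P-of : ∀ {y} → y ∈ ys → P y
  P-of = proj₂ ∘ ∈-filter⁻ P? {xs = downFrom M}

part-bounds : ∀ {y} (μ : BarPartition) → y ∈ᵇ μ → 0 < y × y < suc (sum (parts μ))
part-bounds μ y∈ = All.lookup (positive μ) y∈ , s≤s (∈⇒≤sum y∈)

module _ {ℓ : ℕ} {μ : BarPartition} (core : IsBarCore ℓ μ) where

  private
    M : ℕ
    M = suc (sum (parts μ))

  barCore-∸ : ∀ {x} → x ∈ᵇ μ → ℓ < x → (x ∸ ℓ) ∈ᵇ μ
  barCore-∸ {x} x∈ ℓ<x with (x ∸ ℓ) ∈? parts μ
  ... | yes x∸ℓ∈ = x∸ℓ∈
  ... | no  x∸ℓ∉ =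
    let ν , ν≈ = barPartition-of M (λ y → (y ∈? parts μ ×-dec ¬? (y ≟ x)) ⊎-dec y ≟ x ∸ ℓ) bounded
    in  ⊥-elim (core ν (shift x x∈ ℓ<x x∸ℓ∉ ν≈))
    where
    bounded : ∀ {y} → (y ∈ᵇ μ × y ≢ x) ⊎ y ≡ x ∸ ℓ → 0 < y × y < M
    bounded (inj₁ (y∈ , _)) = part-bounds μ y∈
    bounded (inj₂ refl)     = m<n⇒0<n∸m ℓ<x , ≤-<-trans (m∸n≤m x ℓ) (proj₂ (part-bounds μ x∈))

  barCore-ℓ∉ : ¬ ℓ ∈ᵇ μ
  barCore-ℓ∉ ℓ∈ =
    let ν , ν≈ = barPartition-of M (λ y → y ∈? parts μ ×-dec ¬? (y ≟ ℓ)) (part-bounds μ ∘ proj₁)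
    in  core ν (delete ℓ∈ ν≈)

  barCore-+ : ∀ {x y} → x ∈ᵇ μ → y ∈ᵇ μ → x + y ≢ ℓ
  barCore-+ {x} {y} x∈ y∈ x+y≡ℓ =
    let ν , ν≈ = barPartition-of M (λ z → z ∈? parts μ ×-dec ¬? (z ≟ x) ×-dec ¬? (z ≟ y)) (part-bounds μ ∘ proj₁)
    in  core ν (pair x y x∈ y∈ x+y≡ℓ ν≈)

  barCore-+ℓ : ∀ {q} → q ∉ parts μ → q + ℓ ∉ parts μ
  barCore-+ℓ {zero}  _  = barCore-ℓ∉
  barCore-+ℓ {suc q} q∉ q+ℓ∈ = q∉ (subst (_∈ parts μ) (m+n∸n≡m (suc q) ℓ) (barCore-∸ q+ℓ∈ (m<n+m ℓ z<s)))

abacus : ℕ → List ℕ → ℕ → Bool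
abacus N xs i with N <? i
... | yes _ = does (i ∸ N ∈? xs)
... | no  _ = not (does (N ∸ i ∈? xs))

abacus-above : ∀ N xs {p} → 0 < p → abacus N xs (N + p) ≡ does (p ∈? xs)
abacus-above N xs {p} p>0 with N <? N + p
... | yes _   = cong (λ q → does (q ∈? xs)) (m+n∸m≡n N p)
... | no  N≮ = contradiction (m<m+n N p>0) N≮

abacus-below : ∀ N xs {p} → p ≤ N → abacus N xs (N ∸ p) ≡ not (does (p ∈? xs))
abacus-below N xs {p} p≤N with N <? N ∸ p
... | yes N< = contradiction N< (≤⇒≯ (m∸n≤m N p))
... | no  _  = cong (λ q → not (does (q ∈? xs))) (m∸[m∸n]≡n p≤N)

above-or-below : ∀ N i → (∃ λ p → 0 < p × N + p ≡ i) ⊎ (∃ λ p → p ≤ N × N ∸ p ≡ i)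
above-or-below N i with N <? i
... | yes N<i = inj₁ (i ∸ N , m<n⇒0<n∸m N<i , m+[n∸m]≡n (<⇒≤ N<i))
... | no  N≮i = inj₂ (N ∸ i , m∸n≤m N i , m∸[m∸n]≡n (≮⇒≥ N≮i))

module _ (N : ℕ) {xs : List ℕ} where

  bead-above : ∀ {p} → 0 < p → p ∈ xs → abacus N xs (N + p) ≡ true
  bead-above p>0 p∈ = trans (abacus-above N xs p>0) (dec-true (_ ∈? xs) p∈)

  gap-above : ∀ {p} → 0 < p → p ∉ xs → abacus N xs (N + p) ≡ false
  gap-above p>0 p∉ = trans (abacus-above N xs p>0) (dec-false (_ ∈? xs) p∉)

  bead-below : ∀ {p} → p ≤ N → p ∉ xs → abacus N xs (N ∸ p) ≡ true
  bead-below p≤N p∉ = trans (abacus-below N xs p≤N) (cong not (dec-false (_ ∈? xs) p∉))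

  gap-below : ∀ {p} → p ≤ N → p ∈ xs → abacus N xs (N ∸ p) ≡ false
  gap-below p≤N p∈ = trans (abacus-below N xs p≤N) (cong not (dec-true (_ ∈? xs) p∈))

  bead-above⁻ : ∀ {p} → 0 < p → abacus N xs (N + p) ≡ true → p ∈ xs
  bead-above⁻ {p} p>0 bead = dec-true⁻ (p ∈? xs) (trans (sym (abacus-above N xs p>0)) bead)

  bead-below⁻ : ∀ {p} → p ≤ N → abacus N xs (N ∸ p) ≡ true → p ∉ xs
  bead-below⁻ p≤N bead p∈ = contradiction (trans (sym bead) (gap-below p≤N p∈)) λ ()

abacus-unchanged : ∀ N {xs ys} (C : ℕ → Set) → (∀ {p} → ¬ C p → p ∈ xs ⇔ p ∈ ys) →
                   ∀ {i} → (∀ {p} → C p → N + p ≢ i × N ∸ p ≢ i) → abacus N xs i ≡ abacus N ys i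
abacus-unchanged N {xs} {ys} C agree {i} avoid with above-or-below N i
... | inj₁ (p , p>0 , refl) = begin
  abacus N xs (N + p) ≡⟨ abacus-above N xs p>0 ⟩
  does (p ∈? xs)      ≡⟨ does-⇔ (agree (λ c → proj₁ (avoid c) refl)) (p ∈? xs) (p ∈? ys) ⟩
  does (p ∈? ys)      ≡⟨ abacus-above N ys p>0 ⟨
  abacus N ys (N + p) ∎
  where open ≡-Reasoning
... | inj₂ (p , p≤N , refl) = begin
  abacus N xs (N ∸ p)  ≡⟨ abacus-below N xs p≤N ⟩
  not (does (p ∈? xs)) ≡⟨ cong not (does-⇔ (agree (λ c → proj₂ (avoid c) refl)) (p ∈? xs) (p ∈? ys)) ⟩
  not (does (p ∈? ys)) ≡⟨ abacus-below N ys p≤N ⟨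
  abacus N ys (N ∸ p)  ∎
  where open ≡-Reasoning

∸-of-+ : ∀ a {n m} → a + n ≡ m → m ∸ a ≡ n
∸-of-+ a {n} refl = m+n∸m≡n a n

module _ {ℓ : ℕ} {μ : BarPartition} (core : IsBarCore ℓ μ) (N : ℕ) where

  private
    xs : List ℕ
    xs = parts μ
    Bead : ℕ → Set
    Bead i = abacus N xs i ≡ true

  bead-above-moves : ∀ {p n} → p ∈ xs → N + p ≡ ℓ + n → Bead n
  bead-above-moves {p} {n} p∈ N+p≡ℓ+n with <-cmp ℓ p
  ... | tri< ℓ<p _ _ = subst Bead (+-cancelˡ-≡ ℓ _ _ ℓ+[N+r]≡ℓ+n) (bead-above N (m<n⇒0<n∸m ℓ<p) (barCore-∸ core p∈ ℓ<p))
    where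
    r : ℕ
    r = p ∸ ℓ
    ℓ+[N+r]≡ℓ+n : ℓ + (N + r) ≡ ℓ + n
    ℓ+[N+r]≡ℓ+n = begin
      ℓ + (N + r) ≡⟨ x∙yz≈y∙xz ℓ N r ⟩
      N + (ℓ + r) ≡⟨ cong (N +_) (m+[n∸m]≡n (<⇒≤ ℓ<p)) ⟩
      N + p       ≡⟨ N+p≡ℓ+n ⟩
      ℓ + n       ∎
      where open ≡-Reasoning
  ... | tri≈ _ refl _ = ⊥-elim (barCore-ℓ∉ core p∈)
  ... | tri> _ _ p<ℓ = subst Bead (∸-of-+ q q+n≡N) (bead-below N (subst (q ≤_) q+n≡N (m≤m+n q n)) q∉)
    where
    q : ℕ
    q = ℓ ∸ p
    q∉ : q ∉ xs
    q∉ q∈ = barCore-+ core p∈ q∈ (m+[n∸m]≡n (<⇒≤ p<ℓ))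
    q+n≡N : q + n ≡ N
    q+n≡N = +-cancelˡ-≡ p _ _ (begin
      p + (q + n) ≡⟨ +-assoc p q n ⟨
      p + q + n   ≡⟨ cong (_+ n) (m+[n∸m]≡n (<⇒≤ p<ℓ)) ⟩
      ℓ + n       ≡⟨ N+p≡ℓ+n ⟨
      N + p       ≡⟨ +-comm N p ⟩
      p + N       ∎)
      where open ≡-Reasoning

  bead-below-moves : ∀ {q n} → q ≤ N → q ∉ xs → N ∸ q ≡ ℓ + n → Bead n
  bead-below-moves {q} {n} q≤N q∉ N∸q≡ℓ+n =
    subst Bead (∸-of-+ (q + ℓ) q+ℓ+n≡N) (bead-below N (subst (q + ℓ ≤_) q+ℓ+n≡N (m≤m+n (q + ℓ) n)) (barCore-+ℓ core q∉))
    where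
    q+ℓ+n≡N : q + ℓ + n ≡ N
    q+ℓ+n≡N = trans (+-assoc q ℓ n) (trans (cong (q +_) (sym N∸q≡ℓ+n)) (m+[n∸m]≡n q≤N))

  barCore⇒flush : Flush ℓ (abacus N xs)
  barCore⇒flush n bead with above-or-below N (ℓ + n)
  ... | inj₁ (p , p>0 , N+p≡ℓ+n) = bead-above-moves (bead-above⁻ N p>0 (subst Bead (sym N+p≡ℓ+n) bead)) N+p≡ℓ+n
  ... | inj₂ (q , q≤N , N∸q≡ℓ+n) = bead-below-moves q≤N (bead-below⁻ N q≤N (subst Bead (sym N∸q≡ℓ+n) bead)) N∸q≡ℓ+n

module _ {t N : ℕ} {μ : BarPartition} (t≤N : t ≤ N) (flush : Flush t (abacus N (parts μ))) where

  private
    Bead : ℕ → Set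
    Bead i = abacus N (parts μ) i ≡ true

  flush⇒barCore : IsBarCore t μ
  flush⇒barCore ν (shift x x∈ t<x x∸t∉ _) =
    x∸t∉ (bead-above⁻ N (m<n⇒0<n∸m t<x) (flush (N + (x ∸ t)) (subst Bead N+x≡ (bead-above N (part-bounds μ x∈ .proj₁) x∈))))
    where
    N+x≡ : N + x ≡ t + (N + (x ∸ t))
    N+x≡ = begin
      N + x             ≡⟨ cong (N +_) (m+[n∸m]≡n (<⇒≤ t<x)) ⟨
      N + (t + (x ∸ t)) ≡⟨ x∙yz≈y∙xz N t (x ∸ t) ⟩
      t + (N + (x ∸ t)) ∎
      where open ≡-Reasoning
  flush⇒barCore ν (delete t∈ _) =
    bead-below⁻ N t≤N (flush (N ∸ t) (subst Bead (sym (m+[n∸m]≡n t≤N)) bead-at-N)) t∈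
    where
    bead-at-N : Bead N
    bead-at-N = bead-below N z≤n (λ 0∈ → <-irrefl refl (part-bounds μ 0∈ .proj₁))
  flush⇒barCore ν (pair x y x∈ y∈ x+y≡t _) =
    bead-below⁻ N y≤N (flush (N ∸ y) (subst Bead N+x≡ (bead-above N (part-bounds μ x∈ .proj₁) x∈))) y∈
    where
    y≤N : y ≤ N
    y≤N = ≤-trans (subst (y ≤_) x+y≡t (m≤n+m y x)) t≤N
    N+x≡ : N + x ≡ t + (N ∸ y)
    N+x≡ = begin
      N + x             ≡⟨ cong (_+ x) (m+[n∸m]≡n y≤N) ⟨
      y + (N ∸ y) + x   ≡⟨ xy∙z≈zx∙y y (N ∸ y) x ⟩
      x + y + (N ∸ y)   ≡⟨ cong (_+ (N ∸ y)) x+y≡t ⟩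
      t + (N ∸ y)       ∎
      where open ≡-Reasoning

Bounded : ℕ → BarPartition → Set
Bounded N ν = ∀ {y} → y ∈ᵇ ν → y < N

removeBar-bounded : ∀ {ℓ N ν ν'} → RemoveBar ℓ ν ν' → Bounded N ν → Bounded N ν'
removeBar-bounded {ℓ} (shift x x∈ _ _ ν'≈) bounded y∈ with Equivalence.to (ν'≈ _) y∈
... | inj₁ (y∈ν , _) = bounded y∈ν
... | inj₂ refl      = ≤-<-trans (m∸n≤m x ℓ) (bounded x∈)
removeBar-bounded (delete _ ν'≈)       bounded y∈ = bounded (proj₁ (Equivalence.to (ν'≈ _) y∈))
removeBar-bounded (pair _ _ _ _ _ ν'≈) bounded y∈ = bounded (proj₁ (Equivalence.to (ν'≈ _) y∈))

removeBars-bounded : ∀ {ℓ N ν ν'} → Star (RemoveBar ℓ) ν ν' → Bounded N ν → Bounded N ν'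
removeBars-bounded ε              = id
removeBars-bounded (step ◅ steps) = removeBars-bounded steps ∘ removeBar-bounded step

module _ (s : ℕ) .{{_ : NonZero s}} where

  %-step : ∀ {a b} → a ≡ b + s → a % s ≡ b % s
  %-step {b = b} a≡b+s = trans (cong (_% s) a≡b+s) ([m+n]%n≡m%n b s)

  below-step : ∀ {N q p} → q + s ≡ p → p ≤ N → N ∸ q ≡ N ∸ p + s
  below-step {N} {q} {p} refl p≤N = ∸-of-+ q (begin
    q + (N ∸ p + s)   ≡⟨ cong (q +_) (+-comm _ s) ⟩
    q + (s + (N ∸ p)) ≡⟨ +-assoc q s _ ⟨
    p + (N ∸ p)       ≡⟨ m+[n∸m]≡n p≤N ⟩
    N                 ∎)
    where open ≡-Reasoning

  above-step : ∀ {N p q} → p + q ≡ s → q ≤ N → N + p ≡ N ∸ q + s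
  above-step {N} {p} {q} refl q≤N = begin
    N + p             ≡⟨ cong (_+ p) (m∸n+n≡m q≤N) ⟨
    N ∸ q + q + p     ≡⟨ +-assoc (N ∸ q) q p ⟩
    N ∸ q + (q + p)   ≡⟨ cong (N ∸ q +_) (+-comm q p) ⟩
    N ∸ q + (p + q)   ∎
    where open ≡-Reasoning

module _ (s : ℕ) .{{_ : NonZero s}} (N : ℕ) where

  open Runners s

  runnerBeads : BarPartition → ℕ → ℕ
  runnerBeads ν r = beads (abacus N (parts ν)) r (N + N)

  private
    W : ℕ
    W = N + N

    above<W : ∀ {p} → p < N → N + p < W
    above<W = +-monoʳ-< N

    below<W : ∀ {p} q → p < N → N ∸ q < W
    below<W q p<N = ≤-<-trans (m∸n≤m N q) (m<m+n N (≤-<-trans z≤n p<N))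

    above≢below : ∀ {p} q → 0 < p → N + p ≢ N ∸ q
    above≢below {p} q p>0 eq = <⇒≱ (m<m+n N p>0) (subst (_≤ N) (sym eq) (m∸n≤m N q))

    below≢above : ∀ {p} q → 0 < p → N ∸ q ≢ N + p
    below≢above q p>0 = above≢below q p>0 ∘ sym

  shift-preserves-beads : ∀ {ν ν' x} → Bounded N ν → x ∈ᵇ ν → s < x → ¬ (x ∸ s) ∈ᵇ ν →
                          (∀ y → y ∈ᵇ ν' ⇔ ((y ∈ᵇ ν × y ≢ x) ⊎ y ≡ x ∸ s)) →
                          ∀ r → runnerBeads ν' r ≡ runnerBeads ν r
  shift-preserves-beads {ν} {ν'} {x} bounded x∈ s<x x'∉ ν'≈ =
    beads-exchange₂ (above<W x<N) (above<W x'<N) (below<W x' x<N) (below<W x x<N)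
      (%-step s N+x≡N+x'+s) (%-step s (below-step s x'+s≡x x≤N)) (below≢above x' x>0) (below≢above x' x'>0)
      (below≢above x x>0) (below≢above x x'>0) exchange
    where
    x<N : x < N
    x<N = bounded x∈
    x' : ℕ
    x' = x ∸ s
    x'+s≡x : x' + s ≡ x
    x'+s≡x = m∸n+n≡m (<⇒≤ s<x)
    x'<x : x' < x
    x'<x = ∸-monoʳ-< (>-nonZero⁻¹ s) (<⇒≤ s<x)
    x'<N : x' < N
    x'<N = <-trans x'<x x<N
    x'>0 : 0 < x'
    x'>0 = m<n⇒0<n∸m s<x
    x>0 : 0 < x
    x>0 = <-trans x'>0 x'<x
    x≤N : x ≤ N
    x≤N = <⇒≤ x<N
    x'≤N : x' ≤ N
    x'≤N = <⇒≤ x'<N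
    N+x≡N+x'+s : N + x ≡ N + x' + s
    N+x≡N+x'+s = trans (cong (N +_) (sym x'+s≡x)) (sym (+-assoc N x' s))
    x∉' : x ∉ parts ν'
    x∉' x∈' with Equivalence.to (ν'≈ x) x∈'
    ... | inj₁ (_ , x≢x) = x≢x refl
    ... | inj₂ x≡x'     = <-irrefl (sym x≡x') x'<x
    x'∈' : x' ∈ parts ν'
    x'∈' = Equivalence.from (ν'≈ x') (inj₂ refl)
    Changed : ℕ → Set
    Changed p = p ≡ x ⊎ p ≡ x'
    agree : ∀ {p} → ¬ Changed p → p ∈ᵇ ν' ⇔ p ∈ᵇ ν
    agree {p} unchanged = mk⇔ to (λ p∈ → Equivalence.from (ν'≈ p) (inj₁ (p∈ , unchanged ∘ inj₁)))
      where
      to : p ∈ᵇ ν' → p ∈ᵇ ν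
      to p∈' with Equivalence.to (ν'≈ p) p∈'
      ... | inj₁ (p∈ , _) = p∈
      ... | inj₂ p≡x'     = ⊥-elim (unchanged (inj₂ p≡x'))
    exchange : Exchange₂ (N + x) (N + x') (N ∸ x') (N ∸ x) (abacus N (parts ν)) (abacus N (parts ν'))
    exchange = record
      { at-a = trans (gap-above N x>0 x∉') (sym (gap-above N x'>0 x'∉))
      ; at-b = trans (bead-above N x'>0 x'∈') (sym (bead-above N x>0 x∈))
      ; at-c = trans (gap-below N x'≤N x'∈') (sym (gap-below N x≤N x∈))
      ; at-d = trans (bead-below N x≤N x∉') (sym (bead-below N x'≤N x'∉))
      ; elsewhere = λ i≢a i≢b i≢c i≢d → abacus-unchanged N Changed agree λ
          { (inj₁ refl) → i≢a ∘ sym , i≢d ∘ sym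
          ; (inj₂ refl) → i≢b ∘ sym , i≢c ∘ sym }
      }

  delete-preserves-beads : ∀ {ν ν'} → Bounded N ν → s ∈ᵇ ν → (∀ y → y ∈ᵇ ν' ⇔ (y ∈ᵇ ν × y ≢ s)) →
                           ∀ r → runnerBeads ν' r ≡ runnerBeads ν r
  delete-preserves-beads {ν} {ν'} bounded s∈ ν'≈ =
    beads-exchange (above<W s<N) (below<W s s<N) (trans (%-step s N+s≡) (%-step s refl)) exchange
    where
    s<N : s < N
    s<N = bounded s∈
    s>0 : 0 < s
    s>0 = >-nonZero⁻¹ s
    s≤N : s ≤ N
    s≤N = <⇒≤ s<N
    N+s≡ : N + s ≡ N ∸ s + s + s
    N+s≡ = cong (_+ s) (sym (m∸n+n≡m s≤N))
    s∉' : s ∉ parts ν'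
    s∉' s∈' = proj₂ (Equivalence.to (ν'≈ s) s∈') refl
    agree : ∀ {p} → ¬ p ≡ s → p ∈ᵇ ν' ⇔ p ∈ᵇ ν
    agree {p} p≢s = mk⇔ (proj₁ ∘ Equivalence.to (ν'≈ p)) (λ p∈ → Equivalence.from (ν'≈ p) (p∈ , p≢s))
    exchange : Exchange (N + s) (N ∸ s) (abacus N (parts ν)) (abacus N (parts ν'))
    exchange = record
      { at-a = trans (gap-above N s>0 s∉') (sym (gap-below N s≤N s∈))
      ; at-b = trans (bead-below N s≤N s∉') (sym (bead-above N s>0 s∈))
      ; elsewhere = λ i≢a i≢b → abacus-unchanged N (_≡ s) agree λ { refl → i≢a ∘ sym , i≢b ∘ sym }
      }

  pair-preserves-beads : ∀ {ν ν' x y} → Odd s → Bounded N ν → x ∈ᵇ ν → y ∈ᵇ ν → x + y ≡ s →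
                         (∀ z → z ∈ᵇ ν' ⇔ (z ∈ᵇ ν × z ≢ x × z ≢ y)) →
                         ∀ r → runnerBeads ν' r ≡ runnerBeads ν r
  pair-preserves-beads {ν} {ν'} {x} {y} (k , s≡1+2k) bounded x∈ y∈ x+y≡s ν'≈ =
    beads-exchange₂ (above<W x<N) (below<W y x<N) (above<W y<N) (below<W x x<N)
      (%-step s (above-step s x+y≡s y≤N)) (%-step s (above-step s (trans (+-comm y x) x+y≡s) x≤N))
      (x≢y ∘ sym ∘ +-cancelˡ-≡ N y x) (above≢below y y>0) (below≢above x x>0)
      (x≢y ∘ ∸-cancelˡ-≡ x≤N y≤N) exchange
    where
    x<N : x < N
    x<N = bounded x∈
    y<N : y < N
    y<N = bounded y∈
    x≤N : x ≤ N
    x≤N = <⇒≤ x<N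
    y≤N : y ≤ N
    y≤N = <⇒≤ y<N
    x>0 : 0 < x
    x>0 = part-bounds ν x∈ .proj₁
    y>0 : 0 < y
    y>0 = part-bounds ν y∈ .proj₁
    x≢y : x ≢ y
    x≢y refl = even≢odd x k (trans (cong (x +_) (+-identityʳ x)) (trans x+y≡s s≡1+2k))
    x∉' : x ∉ parts ν'
    x∉' x∈' = proj₁ (proj₂ (Equivalence.to (ν'≈ x) x∈')) refl
    y∉' : y ∉ parts ν'
    y∉' y∈' = proj₂ (proj₂ (Equivalence.to (ν'≈ y) y∈')) refl
    Changed : ℕ → Set
    Changed p = p ≡ x ⊎ p ≡ y
    agree : ∀ {p} → ¬ Changed p → p ∈ᵇ ν' ⇔ p ∈ᵇ ν
    agree {p} unchanged = mk⇔ (proj₁ ∘ Equivalence.to (ν'≈ p))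
      (λ p∈ → Equivalence.from (ν'≈ p) (p∈ , unchanged ∘ inj₁ , unchanged ∘ inj₂))
    exchange : Exchange₂ (N + x) (N ∸ y) (N + y) (N ∸ x) (abacus N (parts ν)) (abacus N (parts ν'))
    exchange = record
      { at-a = trans (gap-above N x>0 x∉') (sym (gap-below N y≤N y∈))
      ; at-b = trans (bead-below N y≤N y∉') (sym (bead-above N x>0 x∈))
      ; at-c = trans (gap-above N y>0 y∉') (sym (gap-below N x≤N x∈))
      ; at-d = trans (bead-below N x≤N x∉') (sym (bead-above N y>0 y∈))
      ; elsewhere = λ i≢a i≢b i≢c i≢d → abacus-unchanged N Changed agree λ
          { (inj₁ refl) → i≢a ∘ sym , i≢d ∘ sym
          ; (inj₂ refl) → i≢c ∘ sym , i≢b ∘ sym }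
      }

  removeBar-preserves-beads : ∀ {ν ν'} → Odd s → Bounded N ν → RemoveBar s ν ν' →
                              ∀ r → runnerBeads ν' r ≡ runnerBeads ν r
  removeBar-preserves-beads {ν} {ν'} _ bounded (shift x x∈ s<x x∸s∉ ν'≈) =
    shift-preserves-beads {ν} {ν'} bounded x∈ s<x x∸s∉ ν'≈
  removeBar-preserves-beads {ν} {ν'} _ bounded (delete s∈ ν'≈) =
    delete-preserves-beads {ν} {ν'} bounded s∈ ν'≈
  removeBar-preserves-beads {ν} {ν'} odd bounded (pair x y x∈ y∈ x+y≡s ν'≈) =
    pair-preserves-beads {ν} {ν'} odd bounded x∈ y∈ x+y≡s ν'≈

  removeBars-preserves-beads : ∀ {ν ν'} → Odd s → Bounded N ν → Star (RemoveBar s) ν ν' →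
                               ∀ r → runnerBeads ν' r ≡ runnerBeads ν r
  removeBars-preserves-beads odd bounded ε                r = refl
  removeBars-preserves-beads odd bounded (step ◅ steps) r =
    trans (removeBars-preserves-beads odd (removeBar-bounded step bounded) steps r)
          (removeBar-preserves-beads odd bounded step r)

abacus-beyond : ∀ {N μ i} → 0 < N → Bounded N μ → N + N ≤ i → abacus N (parts μ) i ≡ false
abacus-beyond {N} {μ} {i} N>0 bounded N+N≤i =
  subst (λ j → abacus N (parts μ) j ≡ false) (m+[n∸m]≡n N≤i)
        (gap-above N (<-≤-trans N>0 N≤i∸N) (λ i∸N∈ → <⇒≱ (bounded i∸N∈) N≤i∸N))
  where
  N≤i : N ≤ i
  N≤i = ≤-trans (m≤m+n N N) N+N≤i
  N≤i∸N : N ≤ i ∸ N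
  N≤i∸N = subst (_≤ i ∸ N) (m+n∸m≡n N N) (∸-monoˡ-≤ N N+N≤i)

theorem2p3 : (s t : ℕ) → Odd s → Odd t → (lam mu : BarPartition) →
             IsBarCore t lam → IsBarCoreOf s mu lam → IsBarCore t mu
-- Matching on s-odd exposes s as a successor, i.e. NonZero s.
theorem2p3 s t s-odd@(_ , refl) _ lam mu t-core (removals , s-core) =
  flush⇒barCore t≤N
    (flush-transfer {t} (barCore⇒flush t-core N) (barCore⇒flush s-core N)
                    (removeBars-preserves-beads s N s-odd bounded removals)
                    (abacus-beyond {μ = mu} (<-≤-trans z<s (m≤n+m _ t)) (removeBars-bounded removals bounded)))
  where
  open Runners s
  N : ℕ
  N = t + suc (sum (parts lam))
  t≤N : t ≤ N
  t≤N = m≤m+n t _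
  bounded : Bounded N lam
  bounded y∈ = ≤-trans (part-bounds lam y∈ .proj₂) (m≤n+m _ t)
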